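{- Suppose that the edges of the complete bipartite graph $K_{n,n}$ are coloured red and blue. Then the vertex set of $K_{n,n}$ can be partitioned into (the vertex sets of) one red path and two blue balanced complete bipartite graphs.
   Context: A balanced complete bipartite graph is a complete bipartite graph with parts of equal size, here a subgraph of $K_{n,n}$ all of whose edges are blue; it may be empty. A single vertex and the empty graph are considered paths. -}

module Defs where

open import Data.Nat using (ℕ)
open import Data.Fin using (Fin)
open import Data.Sum using (_⊎_; inj₁; inj₂)
open import Data.Product using (_×_; Σ-syntax)
open import Data.List using (List; []; _∷_; _++_; map; length)
open import Data.List.Membership.Propositional using (_∈_)
open import Data.List.Relation.Unary.Unique.Propositional using (Unique)
open import Relation.Binary.PropositionalEquality using (_≡_)

data Colour : Set where
  red blue : Colour

-- A red/blue colouring of the edges of K_{n,n}: the edge between the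
-- i-th vertex of the left part and the j-th vertex of the right part
-- receives colour  c i j.
Colouring : ℕ → Set
Colouring n = Fin n → Fin n → Colour

-- Vertices of K_{n,n}: inj₁ i (left part) and inj₂ j (right part).
Vertex : ℕ → Set
Vertex n = Fin n ⊎ Fin n

data RedEdge {n : ℕ} (c : Colouring n) : Vertex n → Vertex n → Set where
  lr : ∀ {i j} → c i j ≡ red → RedEdge c (inj₁ i) (inj₂ j)
  rl : ∀ {i j} → c i j ≡ red → RedEdge c (inj₂ j) (inj₁ i)

data RedWalk {n : ℕ} (c : Colouring n) : List (Vertex n) → Set where
  []  : RedWalk c []
  [_] : ∀ v → RedWalk c (v ∷ [])
  _∷_ : ∀ {u v vs} → RedEdge c u v → RedWalk c (v ∷ vs) → RedWalk c (u ∷ v ∷ vs)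

-- A red path (possibly empty or a single vertex), given by its vertex
-- sequence: distinct vertices, consecutive ones joined by red edges.
RedPath : {n : ℕ} → Colouring n → List (Vertex n) → Set
RedPath c P = Unique P × RedWalk c P

-- A blue balanced complete bipartite subgraph with parts X (left side)
-- and Y (right side): |X| = |Y| and every edge between X and Y is blue.
-- (A balanced complete bipartite subgraph of K_{n,n} with at least one
-- edge necessarily has its two parts on opposite sides; the empty one
-- is X = Y = [].)
BlueBalancedBiclique : {n : ℕ} → Colouring n → List (Fin n) → List (Fin n) → Set
BlueBalancedBiclique c X Y =
  Unique X × Unique Y × length X ≡ length Y ×
  (∀ {i j} → i ∈ X → j ∈ Y → c i j ≡ blue)

bicliqueVertices : {n : ℕ} → List (Fin n) → List (Fin n) → List (Vertex n)
bicliqueVertices X Y = map inj₁ X ++ map inj₂ Y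

IsPartitionList : {n : ℕ} → List (Vertex n) → Set
IsPartitionList {n} L = Unique L × (∀ (v : Vertex n) → v ∈ L)

-- Run a depth-first search along red edges, keeping the current red path as
-- a stack S, the finished vertices F and the unvisited vertices U.  A vertex
-- is finished only when it has no red neighbour left in U, so no red edge ever
-- joins F to U: the left half of F with the right half of U, and the left half
-- of U with the right half of F, span blue complete bipartite graphs.  Each
-- step moves one vertex from U to S or from S to F, so |U| − |F| drops by one
-- per step, and we stop when |U| = |F|.  Counting both sides of K_{n,n} then
-- shows that the difference between the two halves of the red path is twice
-- the imbalance of the bicliques; as the path alternates between the sides,
-- that difference is at most one, hence zero.
module Submission where

open import Defs
open import Data.Nat using (ℕ; zero; suc; _+_; _*_)
open import Data.Nat.Properties
  using (+-suc; +-comm; +-identityʳ; +-cancelˡ-≡; +-cancelʳ-≡; *-cancelˡ-≡; suc-injective; even≢odd)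
open import Data.Nat.Tactic.RingSolver using (solve-∀)
open import Data.Fin using (Fin)
open import Data.Maybe using (Maybe; just; nothing)
open import Data.Sum using (_⊎_; inj₁; inj₂)
open import Data.Sum.Properties using (inj₁-injective; inj₂-injective)
open import Data.Product using (_×_; _,_; proj₁; proj₂; Σ-syntax; ∃-syntax)
open import Data.Empty using (⊥-elim)
open import Data.List using (List; []; _∷_; _++_; map; length; mapMaybe; allFin)
open import Data.List.Properties using (++-assoc; length-++; mapMaybe-++)
open import Data.List.Relation.Unary.Any using (here; there; any?)
import Data.List.Relation.Unary.All.Properties as All
open import Data.List.Relation.Unary.AllPairs using (_∷_)
open import Data.List.Relation.Unary.Unique.Propositional using (Unique; [])
import Data.List.Relation.Unary.Unique.Propositional.Properties as Unique
open import Data.List.Membership.Propositional using (_∈_; find; lose)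
open import Data.List.Membership.Propositional.Properties
  using (∈-∃++; ∈-++⁺ˡ; ∈-++⁺ʳ; ∈-map⁺; ∈-map⁻; ∈-allFin)
open import Data.List.Relation.Binary.Permutation.Propositional
  using (_↭_; ↭-refl; ↭-sym; ↭-trans; ↭-prep; ↭⇒↭ₛ; module PermutationReasoning)
open import Data.List.Relation.Binary.Permutation.Propositional.Properties
  using (↭-length; ∈-resp-↭; mapMaybe-↭; shift; shifts; ++-comm; ++⁺ˡ; ++⁺)
import Data.List.Relation.Binary.Permutation.Setoid.Properties as SetoidPermutation
open import Relation.Nullary using (¬_; Dec; yes; no)
open import Relation.Nullary.Decidable using (map′)
open import Relation.Binary.PropositionalEquality
  using (_≡_; _≢_; refl; sym; trans; cong; cong₂; setoid; module ≡-Reasoning)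

module _ {A : Set} where

  Unique-++⁻ : ∀ (xs : List A) {ys} → Unique (xs ++ ys) → Unique xs × Unique ys
  Unique-++⁻ []       u          = [] , u
  Unique-++⁻ (x ∷ xs) (x∉ ∷ u) with ux , uy ← Unique-++⁻ xs u = All.++⁻ˡ xs x∉ ∷ ux , uy

  Unique-resp-↭ : ∀ {xs ys : List A} → xs ↭ ys → Unique xs → Unique ys
  Unique-resp-↭ p = SetoidPermutation.Unique-resp-↭ (setoid A) (↭⇒↭ₛ p)

  ∈⇒↭∷ : ∀ {x : A} {xs} → x ∈ xs → ∃[ ys ] xs ↭ x ∷ ys
  ∈⇒↭∷ {x} x∈xs with ys , zs , refl ← ∈-∃++ x∈xs = ys ++ zs , shift x ys zs

  shift-↭ : ∀ {x : A} {xs xs′} ys → xs ↭ x ∷ xs′ → x ∷ ys ++ xs′ ↭ ys ++ xs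
  shift-↭ {x} {xs′ = xs′} ys p = ↭-trans (↭-sym (shift x ys xs′)) (++⁺ˡ ys (↭-sym p))

  exchange-tails : ∀ (as bs cs ds : List A) → (as ++ bs) ++ (cs ++ ds) ↭ (as ++ ds) ++ (cs ++ bs)
  exchange-tails as bs cs ds = begin
    (as ++ bs) ++ (cs ++ ds)  ≡⟨ ++-assoc as bs (cs ++ ds) ⟩
    as ++ bs ++ cs ++ ds      ↭⟨ ++⁺ˡ as (shifts bs cs) ⟩
    as ++ cs ++ bs ++ ds      ↭⟨ ++⁺ˡ as (++⁺ˡ cs (++-comm bs ds)) ⟩
    as ++ cs ++ ds ++ bs      ↭⟨ ++⁺ˡ as (shifts cs ds) ⟩
    as ++ ds ++ cs ++ bs      ≡⟨ ++-assoc as ds (cs ++ bs) ⟨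
    (as ++ ds) ++ (cs ++ bs)  ∎
    where open PermutationReasoning

module _ {A B : Set} where

  length-mapMaybe-++ : ∀ (f : A → Maybe B) xs ys →
    length (mapMaybe f (xs ++ ys)) ≡ length (mapMaybe f xs) + length (mapMaybe f ys)
  length-mapMaybe-++ f xs ys = trans (cong length (mapMaybe-++ f xs ys)) (length-++ (mapMaybe f xs))

  fromInj₁ : A ⊎ B → Maybe A
  fromInj₁ (inj₁ x) = just x
  fromInj₁ (inj₂ _) = nothing

  fromInj₂ : A ⊎ B → Maybe B
  fromInj₂ (inj₁ _) = nothing
  fromInj₂ (inj₂ y) = just y

  lefts : List (A ⊎ B) → List A
  lefts = mapMaybe fromInj₁

  rights : List (A ⊎ B) → List B
  rights = mapMaybe fromInj₂

  length≡lefts+rights : ∀ xs → length xs ≡ length (lefts xs) + length (rights xs)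
  length≡lefts+rights []            = refl
  length≡lefts+rights (inj₁ _ ∷ xs) = cong suc (length≡lefts+rights xs)
  length≡lefts+rights (inj₂ _ ∷ xs) =
    trans (cong suc (length≡lefts+rights xs)) (sym (+-suc (length (lefts xs)) _))

  lefts-rights-↭ : ∀ xs → map inj₁ (lefts xs) ++ map inj₂ (rights xs) ↭ xs
  lefts-rights-↭ []            = ↭-refl
  lefts-rights-↭ (inj₁ x ∷ xs) = ↭-prep (inj₁ x) (lefts-rights-↭ xs)
  lefts-rights-↭ (inj₂ y ∷ xs) =
    ↭-trans (shift (inj₂ y) (map inj₁ (lefts xs)) _) (↭-prep (inj₂ y) (lefts-rights-↭ xs))

  ∈-lefts⁻ : ∀ {x} xs → x ∈ lefts xs → inj₁ x ∈ xs
  ∈-lefts⁻ (inj₁ _ ∷ xs) (here refl) = here refl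
  ∈-lefts⁻ (inj₁ _ ∷ xs) (there x∈)  = there (∈-lefts⁻ xs x∈)
  ∈-lefts⁻ (inj₂ _ ∷ xs) x∈          = there (∈-lefts⁻ xs x∈)

  ∈-rights⁻ : ∀ {y} xs → y ∈ rights xs → inj₂ y ∈ xs
  ∈-rights⁻ (inj₂ _ ∷ xs) (here refl) = here refl
  ∈-rights⁻ (inj₂ _ ∷ xs) (there y∈)  = there (∈-rights⁻ xs y∈)
  ∈-rights⁻ (inj₁ _ ∷ xs) y∈          = there (∈-rights⁻ xs y∈)

  lefts-++-map : ∀ xs ys → lefts (map inj₁ xs ++ map inj₂ ys) ≡ xs
  lefts-++-map (x ∷ xs) ys       = cong (x ∷_) (lefts-++-map xs ys)
  lefts-++-map []       []       = refl
  lefts-++-map []       (y ∷ ys) = lefts-++-map [] ys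

  rights-++-map : ∀ xs ys → rights (map inj₁ xs ++ map inj₂ ys) ≡ ys
  rights-++-map (x ∷ xs) ys       = rights-++-map xs ys
  rights-++-map []       []       = refl
  rights-++-map []       (y ∷ ys) = cong (y ∷_) (rights-++-map [] ys)

  lefts-rights-exchange-↭ : ∀ xs ys →
    (map inj₁ (lefts xs) ++ map inj₂ (rights ys)) ++ (map inj₁ (lefts ys) ++ map inj₂ (rights xs))
      ↭ xs ++ ys
  lefts-rights-exchange-↭ xs ys =
    ↭-trans (exchange-tails (map inj₁ (lefts xs)) (map inj₂ (rights ys)) (map inj₁ (lefts ys)) _)
      (++⁺ (lefts-rights-↭ xs) (lefts-rights-↭ ys))

  ++-map-unique : ∀ {xs : List A} {ys : List B} → Unique xs → Unique ys → Unique (map inj₁ xs ++ map inj₂ ys)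
  ++-map-unique {xs} {ys} uxs uys =
    Unique.++⁺ (Unique.map⁺ inj₁-injective uxs) (Unique.map⁺ inj₂-injective uys) disjoint
    where
    disjoint : ∀ {v} → ¬ (v ∈ map inj₁ xs × v ∈ map inj₂ ys)
    disjoint (v∈₁ , v∈₂) with ∈-map⁻ inj₁ v∈₁ | ∈-map⁻ inj₂ v∈₂
    ... | _ , _ , refl | _ , _ , ()

data Near : ℕ → ℕ → Set where
  equal  : ∀ {m} → Near m m
  ahead  : ∀ {m} → Near (suc m) m
  behind : ∀ {m} → Near m (suc m)

Near-suc : ∀ {m n} → Near m n → Near (suc m) (suc n)
Near-suc equal  = equal
Near-suc ahead  = ahead
Near-suc behind = behind

Near-+-double-cancel : ∀ {s t} c d → Near s t → s + 2 * c ≡ t + 2 * d → c ≡ d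
Near-+-double-cancel {s}     c d equal  eq = *-cancelˡ-≡ c d 2 (+-cancelˡ-≡ s _ _ eq)
Near-+-double-cancel {suc t} c d ahead  eq =
  ⊥-elim (even≢odd d c (sym (+-cancelˡ-≡ t _ _ (trans (+-suc t (2 * c)) eq))))
Near-+-double-cancel {s}     c d behind eq =
  ⊥-elim (even≢odd c d (+-cancelˡ-≡ s _ _ (trans eq (sym (+-suc s (2 * d))))))

sides-balanced : ∀ {sₗ sᵣ a b c d} → Near sₗ sᵣ →
  sₗ + (a + c) ≡ sᵣ + (d + b) → c + b ≡ a + d → a ≡ b × c ≡ d
sides-balanced {sₗ} {sᵣ} {a} {b} {c} {d} near sides halves = a≡b , c≡d
  where
  open ≡-Reasoning
  regroupₗ : ∀ s a b c → s + 2 * c + (a + b) ≡ (s + (a + c)) + (c + b)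
  regroupₗ = solve-∀
  regroupᵣ : ∀ s a b d → (s + (d + b)) + (a + d) ≡ s + 2 * d + (a + b)
  regroupᵣ = solve-∀
  c≡d : c ≡ d
  c≡d = Near-+-double-cancel c d near (+-cancelʳ-≡ _ (sₗ + 2 * c) (sᵣ + 2 * d) (begin
    sₗ + 2 * c + (a + b)        ≡⟨ regroupₗ sₗ a b c ⟩
    (sₗ + (a + c)) + (c + b)    ≡⟨ cong₂ _+_ sides halves ⟩
    (sᵣ + (d + b)) + (a + d)    ≡⟨ regroupᵣ sᵣ a b d ⟩
    sᵣ + 2 * d + (a + b)        ∎))
  a≡b : a ≡ b
  a≡b = sym (+-cancelˡ-≡ d _ _ (begin
    d + b  ≡⟨ cong (_+ b) (sym c≡d) ⟩
    c + b  ≡⟨ halves ⟩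
    a + d  ≡⟨ +-comm a d ⟩
    d + a  ∎))

isRed? : (k : Colour) → Dec (k ≡ red)
isRed? red  = yes refl
isRed? blue = no λ ()

not-red⇒blue : ∀ {k} → k ≢ red → k ≡ blue
not-red⇒blue {red}  k≢red = ⊥-elim (k≢red refl)
not-red⇒blue {blue} _     = refl

module RedGraph {n : ℕ} (c : Colouring n) where

  V : Set
  V = Vertex n

  redEdge? : (u v : V) → Dec (RedEdge c u v)
  redEdge? (inj₁ i) (inj₂ j) = map′ lr (λ { (lr r) → r }) (isRed? (c i j))
  redEdge? (inj₂ j) (inj₁ i) = map′ rl (λ { (rl r) → r }) (isRed? (c i j))
  redEdge? (inj₁ _) (inj₁ _) = no λ ()
  redEdge? (inj₂ _) (inj₂ _) = no λ ()

  RedEdge-sym : ∀ {u v} → RedEdge c u v → RedEdge c v u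
  RedEdge-sym (lr r) = rl r
  RedEdge-sym (rl r) = lr r

  RedWalk-tail : ∀ {v vs} → RedWalk c (v ∷ vs) → RedWalk c vs
  RedWalk-tail [ _ ]   = []
  RedWalk-tail (_ ∷ w) = w

  -- Each red edge consumes one vertex of each side.
  RedWalk-near : ∀ {vs} → RedWalk c vs → Near (length (lefts vs)) (length (rights vs))
  RedWalk-near []                 = equal
  RedWalk-near [ inj₁ _ ]         = ahead
  RedWalk-near [ inj₂ _ ]         = behind
  RedWalk-near (lr _ ∷ [ _ ])     = equal
  RedWalk-near (rl _ ∷ [ _ ])     = equal
  RedWalk-near (lr _ ∷ (_ ∷ w))   = Near-suc (RedWalk-near w)
  RedWalk-near (rl _ ∷ (_ ∷ w))   = Near-suc (RedWalk-near w)

  Separated : List V → List V → Set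
  Separated X Y = ∀ {x y} → x ∈ X → y ∈ Y → ¬ RedEdge c x y

  Separated-sym : ∀ {X Y} → Separated X Y → Separated Y X
  Separated-sym sep y∈ x∈ r = sep x∈ y∈ (RedEdge-sym r)

  Separated⇒BlueBalancedBiclique : ∀ {X Y} → Separated X Y →
    length (lefts X) ≡ length (rights Y) → Unique (bicliqueVertices (lefts X) (rights Y)) →
    BlueBalancedBiclique c (lefts X) (rights Y)
  Separated⇒BlueBalancedBiclique {X} {Y} sep balanced u
    with uX , uY ← Unique-++⁻ (map inj₁ (lefts X)) u =
    Unique.map⁻ uX , Unique.map⁻ uY , balanced ,
    λ i∈ j∈ → not-red⇒blue λ r → sep (∈-lefts⁻ X i∈) (∈-rights⁻ Y j∈) (lr r)

  allVertices : List V
  allVertices = bicliqueVertices (allFin n) (allFin n)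

  allVertices-partition : IsPartitionList allVertices
  allVertices-partition = ++-map-unique (Unique.allFin⁺ n) (Unique.allFin⁺ n) , covers
    where
    covers : ∀ v → v ∈ allVertices
    covers (inj₁ i) = ∈-++⁺ˡ (∈-map⁺ inj₁ (∈-allFin i))
    covers (inj₂ j) = ∈-++⁺ʳ (map inj₁ (allFin n)) (∈-map⁺ inj₂ (∈-allFin j))

  IsPartitionList-resp-↭ : ∀ {xs ys : List V} → xs ↭ ys → IsPartitionList xs → IsPartitionList ys
  IsPartitionList-resp-↭ p (u , covers) = Unique-resp-↭ p u , λ v → ∈-resp-↭ p (covers v)

  ↭allVertices⇒sides-equal : ∀ {xs} → xs ↭ allVertices → length (lefts xs) ≡ length (rights xs)
  ↭allVertices⇒sides-equal {xs} p = begin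
    length (lefts xs)           ≡⟨ ↭-length (mapMaybe-↭ _ p) ⟩
    length (lefts allVertices)  ≡⟨ cong length (lefts-++-map (allFin n) (allFin n)) ⟩
    length (allFin n)           ≡⟨ cong length (rights-++-map (allFin n) (allFin n)) ⟨
    length (rights allVertices) ≡⟨ ↭-length (mapMaybe-↭ _ p) ⟨
    length (rights xs)          ∎
    where open ≡-Reasoning

  record Invariant (S F U : List V) : Set where
    field
      partition : S ++ F ++ U ↭ allVertices
      redWalk   : RedWalk c S
      separated : Separated F U

  visit : ∀ {S F U u U′} → Invariant S F U → U ↭ u ∷ U′ → RedWalk c (u ∷ S) →
    Invariant (u ∷ S) F U′
  visit {S} {F} inv U↭ walk = record
    { partition = ↭-trans (shift-↭ S (↭-sym (shift-↭ F U↭))) partition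
    ; redWalk   = walk
    ; separated = λ f∈ u∈ → separated f∈ (∈-resp-↭ (↭-sym U↭) (there u∈))
    }
    where open Invariant inv

  retreat : ∀ {t S F U} → Invariant (t ∷ S) F U → (∀ {u} → u ∈ U → ¬ RedEdge c t u) →
    Invariant S (t ∷ F) U
  retreat {t} {S} {F} {U} inv dead-end = record
    { partition = ↭-trans (shift t S (F ++ U)) partition
    ; redWalk   = RedWalk-tail redWalk
    ; separated = λ { (here refl) → dead-end ; (there f∈) → separated f∈ }
    }
    where open Invariant inv

  record Halted : Set where
    field
      path finished unvisited : List V
      invariant : Invariant path finished unvisited
      balanced  : length unvisited ≡ length finished

  search : ∀ d {S F U} → Invariant S F U → length U ≡ d + length F → Halted
  search zero inv eq = record { invariant = inv ; balanced = eq }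
  search (suc d) {[]} {U = []}    inv ()
  search (suc d) {[]} {U = u ∷ _} inv eq = search d (visit inv ↭-refl [ u ]) (suc-injective eq)
  search (suc d) {t ∷ S} {F} {U} inv eq with any? (redEdge? t) U
  ... | yes red-neighbour with u , u∈U , t-u ← find red-neighbour = push (∈⇒↭∷ u∈U) t-u
    where
    push : ∀ {u} → ∃[ U′ ] U ↭ u ∷ U′ → RedEdge c t u → Halted
    push (U′ , U↭) t-u = search d (visit inv U↭ (RedEdge-sym t-u ∷ Invariant.redWalk inv))
      (suc-injective (trans (sym (↭-length U↭)) eq))
  ... | no none =
    search d (retreat inv λ u∈U t-u → none (lose u∈U t-u)) (trans eq (sym (+-suc d (length F))))

  halted : Halted
  halted = search (length allVertices) {[]} {[]} {allVertices}
    (record { partition = ↭-refl ; redWalk = [] ; separated = λ () })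
    (sym (+-identityʳ _))

  Halted-bicliques-balanced : (h : Halted) → let open Halted h in
    length (lefts finished) ≡ length (rights unvisited) ×
    length (lefts unvisited) ≡ length (rights finished)
  Halted-bicliques-balanced h =
    sides-balanced (RedWalk-near redWalk) sides (trans (sym (length≡lefts+rights U)) halves)
    where
    open Halted h renaming (path to S; finished to F; unvisited to U)
    open Invariant invariant
    count : ∀ f → length (mapMaybe f (S ++ F ++ U)) ≡
      length (mapMaybe f S) + (length (mapMaybe f F) + length (mapMaybe f U))
    count f = trans (length-mapMaybe-++ f S _) (cong (length (mapMaybe f S) +_) (length-mapMaybe-++ f F U))
    sides : length (lefts S) + (length (lefts F) + length (lefts U)) ≡
      length (rights S) + (length (rights F) + length (rights U))
    sides = trans (sym (count fromInj₁)) (trans (↭allVertices⇒sides-equal partition) (count fromInj₂))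
    halves : length U ≡ length (lefts F) + length (rights F)
    halves = trans balanced (length≡lefts+rights F)

lemma5p9 : (n : ℕ) → (c : Colouring n) →
    Σ[ P ∈ List (Vertex n) ] Σ[ X₁ ∈ List (Fin n) ] Σ[ Y₁ ∈ List (Fin n) ]
    Σ[ X₂ ∈ List (Fin n) ] Σ[ Y₂ ∈ List (Fin n) ]
      (RedPath c P × BlueBalancedBiclique c X₁ Y₁ × BlueBalancedBiclique c X₂ Y₂ ×
       IsPartitionList (P ++ bicliqueVertices X₁ Y₁ ++ bicliqueVertices X₂ Y₂))
lemma5p9 n c =
  S , lefts F , rights U , lefts U , rights F ,
  (S-unique , redWalk) ,
  Separated⇒BlueBalancedBiclique separated FU-balanced B₁-unique ,
  Separated⇒BlueBalancedBiclique (Separated-sym separated) UF-balanced B₂-unique ,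
  partition′
  where
  open RedGraph c
  open Halted halted renaming (path to S; finished to F; unvisited to U)
  open Invariant invariant
  B₁ B₂ : List (Vertex n)
  B₁ = bicliqueVertices (lefts F) (rights U)
  B₂ = bicliqueVertices (lefts U) (rights F)
  FU-balanced : length (lefts F) ≡ length (rights U)
  FU-balanced = Halted-bicliques-balanced halted .proj₁
  UF-balanced : length (lefts U) ≡ length (rights F)
  UF-balanced = Halted-bicliques-balanced halted .proj₂
  partition′ : IsPartitionList (S ++ B₁ ++ B₂)
  partition′ = IsPartitionList-resp-↭
    (↭-sym (↭-trans (++⁺ˡ S (lefts-rights-exchange-↭ F U)) partition)) allVertices-partition
  S-unique : Unique S
  S-unique = Unique-++⁻ S (partition′ .proj₁) .proj₁
  B-unique : Unique (B₁ ++ B₂)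
  B-unique = Unique-++⁻ S (partition′ .proj₁) .proj₂
  B₁-unique : Unique B₁
  B₁-unique = Unique-++⁻ B₁ B-unique .proj₁
  B₂-unique : Unique B₂
  B₂-unique = Unique-++⁻ B₁ B-unique .proj₂
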